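{- Let $n\ge2$, $\lambda$ a strict partition, and $T\in\mathrm{PT}_n(\lambda)$. Then the odd Kashiwara operator $\tilde e_{\bar1}^P$ acts as follows: if $T_{1,1}=2$, then $\tilde e_{\bar1}^PT$ is obtained from $T$ by changing $T_{1,1}$ to $1$; if $T_{1,i}=2'$ for some $i\ge2$, then $\tilde e_{\bar1}^PT$ is obtained from $T$ by changing $T_{1,i}$ to $1$; otherwise $\tilde e_{\bar1}^PT=\mathbf 0$.
   Context: Shifted diagram of a strict partition $\lambda=(\lambda_1>\dots>\lambda_l>0)$: $S(\lambda)=\{(i,j):1\le i\le l,\ i\le j\le\lambda_i+i-1\}$; $T_{i,j}$ is the entry at row $i$ (row 1 on top), column $j$; the main diagonal is $\{(i,i)\}$. A primed tableau of shape $\lambda$ is a filling of $S(\lambda)$ with letters $1'<1<2'<2<\dots<n'<n$ such that entries weakly increase along rows and columns, each row contains at most one $i'$ for each $i$, each column contains at most one $i$ for each $i$, and there are no primed letters on the main diagonal; $\mathrm{PT}_n(\lambda)$ is the set of these. A standard shifted Young tableau of shape $\lambda$ is a filling of $S(\lambda)$ with $1,\dots,|\lambda|$, each once, increasing along rows and columns. Words: for a word $\boldsymbol b=b_1\cdots b_m$ over $\{1,\dots,n\}$: if there is no letter $2$, $\tilde e_{\bar1}\boldsymbol b=\mathbf 0$; otherwise let $b_k$ be the leftmost $2$; if a letter $1$ occurs among $b_1,\dots,b_{k-1}$ then $\tilde e_{\bar1}\boldsymbol b=\mathbf 0$, otherwise $\tilde e_{\bar 1}\boldsymbol b$ is $\boldsymbol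 b$ with $b_k$ changed to $1$. Semistandard shifted mixed insertion: for $\boldsymbol b=b_1\cdots b_m$, build $(T^{(0)},Q^{(0)})=(\emptyset,\emptyset)$ and $(T^{(i)},Q^{(i)})$ from $(T^{(i-1)},Q^{(i-1)})$: insert $x=b_i$ into the first row, bumping the leftmost entry strictly greater than $x$ (replacing it by $x$), or appending $x$ at the end of the row and stopping if there is none. If $a$ is bumped: if $a$ was off the main diagonal and unprimed, insert $a$ into the next row (bump leftmost entry strictly greater than $a$, or append at the end of the row); if $a$ was off the diagonal and primed, insert $a$ into the next column to the right (bump topmost entry strictly greater than $a$, or append at the bottom of the column); if $a$ was on the main diagonal, replace it by $a'$ and insert into the column to the right likewise. Repeat until an entry is appended. $Q^{(i)}$ is $Q^{(i-1)}$ plus entry $i$ in the new box. $\mathrm{HM}(\boldsymbol b)=(T^{(m)},Q^{(m)})$, $P_{HM}(\boldsymbol b)=T^{(m)}$; $\mathrm{HM}$ is a bijection from words of length $m$ onto pairs $(T,Q)$ with $T$ a primed tableau and $Q$ a standard shifted Young tableau of the same strict shape of size $m$. Definition of the operator: for $|\lambda|=m$, fix a standard shifted Young tableau $Q_\lambda$ of shape $\lambda$ and set $\tilde e_{\bar1}^PT=P_{HM}(\tilde e_{\bar1}(\mathrm{HM}^{ -1}(T,Q_\lambda)))$ (equal to $\mathbf 0$ if $\tilde e_{\bar1}$ of the word is $\mathbf 0$). -}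

module Defs where

open import Data.Nat using (ℕ; zero; suc; _+_; _*_; _∸_; _≤_; _<_; _≤ᵇ_; _<ᵇ_; _≡ᵇ_)
open import Data.Bool using (Bool; true; false; if_then_else_)
open import Data.List using (List; []; _∷_; _++_; map; concat; length; upTo)
open import Data.Nat.ListAction using (sum)
open import Data.List.Relation.Unary.All using (All)
open import Data.List.Relation.Unary.Linked using (Linked)
open import Data.List.Relation.Binary.Permutation.Propositional using (_↭_)
open import Data.Maybe using (Maybe; just; nothing; fromMaybe)
open import Data.Product using (_×_; _,_; proj₁)
open import Relation.Binary.PropositionalEquality using (_≡_; _≢_)

-- Letters 1' < 1 < 2' < 2 < ... ; the order is via `code`.

data Entry : Set where
  unp : ℕ → Entry
  pr  : ℕ → Entry

val : Entry → ℕ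
val (unp k) = k
val (pr k)  = k

code : Entry → ℕ
code (unp k) = 2 * k
code (pr k)  = 2 * k ∸ 1

prime : Entry → Entry
prime (unp k) = pr k
prime (pr k)  = pr k

-- Rows and columns are 0-indexed
-- (row 0 = the paper's row 1); row r starts in column r, so the k-th
-- element (0-indexed) of row r sits in column r + k.

lookupL : {A : Set} → List A → ℕ → Maybe A
lookupL []       _       = nothing
lookupL (x ∷ xs) zero    = just x
lookupL (x ∷ xs) (suc k) = lookupL xs k

updateL : {A : Set} → ℕ → (A → A) → List A → List A
updateL _       f []       = []
updateL zero    f (x ∷ xs) = f x ∷ xs
updateL (suc k) f (x ∷ xs) = x ∷ updateL k f xs

entry : {A : Set} → List (List A) → ℕ → ℕ → Maybe A
entry T r c with lookupL T r
... | nothing  = nothing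
... | just row = if r ≤ᵇ c then lookupL row (c ∸ r) else nothing

-- replace the entry at (r , c) (assumes r ≤ c)
setEntry : {A : Set} → List (List A) → ℕ → ℕ → A → List (List A)
setEntry T r c e = updateL r (updateL (c ∸ r) (λ _ → e)) T

appendAt : {A : Set} → ℕ → A → List (List A) → List (List A)
appendAt zero    x []         = (x ∷ []) ∷ []
appendAt zero    x (row ∷ rs) = (row ++ (x ∷ [])) ∷ rs
appendAt (suc r) x []         = [] ∷ appendAt r x []
appendAt (suc r) x (row ∷ rs) = row ∷ appendAt r x rs

shape : {A : Set} → List (List A) → List ℕ
shape = map length

Tableau : Set
Tableau = List (List Entry)

_>_ : ℕ → ℕ → Set
m > n = n < m

StrictPartition : List ℕ → Set
StrictPartition λ' = Linked _>_ λ' × All (λ k → 0 < k) λ'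

record PT (n : ℕ) (λ' : List ℕ) (T : Tableau) : Set where
  field
    shapeEq  : shape T ≡ λ'
    letters  : ∀ r c e → entry T r c ≡ just e → 1 ≤ val e × val e ≤ n
    rowsWeak : ∀ r c c' e e' → c ≤ c' → entry T r c ≡ just e →
               entry T r c' ≡ just e' → code e ≤ code e'
    colsWeak : ∀ c r r' e e' → r ≤ r' → entry T r c ≡ just e →
               entry T r' c ≡ just e' → code e ≤ code e'
    rowPrime : ∀ r c c' k → entry T r c ≡ just (pr k) →
               entry T r c' ≡ just (pr k) → c ≡ c'
    colUnp   : ∀ c r r' k → entry T r c ≡ just (unp k) →
               entry T r' c ≡ just (unp k) → r ≡ r'
    diagUnp  : ∀ r k → entry T r r ≢ just (pr k)

record SYT (λ' : List ℕ) (Q : List (List ℕ)) : Set where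
  field
    shapeEq : shape Q ≡ λ'
    content : concat Q ↭ map suc (upTo (sum λ'))
    rowsInc : ∀ r c c' e e' → c < c' → entry Q r c ≡ just e →
              entry Q r c' ≡ just e' → e < e'
    colsInc : ∀ c r r' e e' → r < r' → entry Q r c ≡ just e →
              entry Q r' c ≡ just e' → e < e'

e1w : List ℕ → Maybe (List ℕ)
e1w []                     = nothing
e1w (1 ∷ xs)               = nothing
e1w (2 ∷ xs)               = just (1 ∷ xs)
e1w (x ∷ xs) with e1w xs
... | nothing = nothing
... | just ys = just (x ∷ ys)

data Job : Set where
  rowIns : ℕ → Entry → Job
  colIns : ℕ → Entry → Job

afterBump : ℕ → ℕ → Entry → Job
afterBump r c a with r ≡ᵇ c
afterBump r c a       | true  = colIns (suc c) (prime a)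
afterBump r c (unp k) | false = rowIns (suc r) (unp k)
afterBump r c (pr k)  | false = colIns (suc c) (pr k)

firstGreater : Entry → List Entry → Maybe ℕ
firstGreater x []       = nothing
firstGreater x (y ∷ ys) with code x <ᵇ code y
... | true  = just zero
... | false with firstGreater x ys
...   | nothing = nothing
...   | just k  = just (suc k)

colFirst : ℕ → Entry → ℕ → Tableau → Maybe ℕ
colFirst c x r []         = nothing
colFirst c x r (row ∷ rs) with entry (row ∷ []) 0 (c ∸ r) | r ≤ᵇ c
... | just y  | true with code x <ᵇ code y
...   | true  = just r
...   | false = colFirst c x (suc r) rs
colFirst c x r (row ∷ rs) | _ | _ = colFirst c x (suc r) rs

colHeight : ℕ → ℕ → Tableau → ℕ
colHeight c r []         = 0
colHeight c r (row ∷ rs) with r ≤ᵇ c | lookupL row (c ∸ r)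
... | true | just _ = suc (colHeight c (suc r) rs)
... | _    | _      = colHeight c (suc r) rs

-- The fuel argument is only for termination: an insertion path visits
-- each row / column at most once, so 2·|T| + 2 steps always suffice.
run : ℕ → Job → Tableau → Tableau × ℕ
run zero    _            T = T , 0
run (suc f) (rowIns r x) T with firstGreater x (fromMaybe [] (lookupL T r))
... | nothing = appendAt r x T , r
... | just k  = run f (afterBump r (r + k) a) (setEntry T r (r + k) x)
  where a = fromMaybe x (lookupL (fromMaybe [] (lookupL T r)) k)
run (suc f) (colIns c x) T with colFirst c x 0 T
... | nothing = appendAt (colHeight c 0 T) x T , colHeight c 0 T
... | just r  = run f (afterBump r c a) (setEntry T r c x)
  where a = fromMaybe x (entry T r c)

fuel : Tableau → ℕ
fuel T = 2 * sum (shape T) + 2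

HM' : ℕ → List ℕ → Tableau → List (List ℕ) → Tableau × List (List ℕ)
HM' i []       T Q = T , Q
HM' i (x ∷ xs) T Q with run (fuel T) (rowIns 0 (unp x)) T
... | T' , r = HM' (suc i) xs T' (appendAt r i Q)

HM : List ℕ → Tableau × List (List ℕ)
HM b = HM' 1 b [] []

PHM : List ℕ → Tableau
PHM b = proj₁ (HM b)

-- ẽ_{1̄}^P applied to the word b = HM⁻¹(T , Q): P_HM(ẽ_{1̄} b), or nothing (= 𝟎)
e1P-word : List ℕ → Maybe Tableau
e1P-word b with e1w b
... | nothing = nothing
... | just b' = just (PHM b')

-- Follow the insertion of b letter by letter.  Before the first 1 or 2 every entry
-- is at least 3'.  The first 1 or 2 enters at the corner, and from then on the first row reads
-- 1 … 1 t rest, with rest and all lower rows made of letters ≥ 2.  If that letter is 1, then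
-- t = 1, ẽ_{1̄} kills b, and the first row keeps this form: T has no 2 in the corner and no 2' in
-- the first row.  If it is 2, ẽ_{1̄} b replaces it by 1; the two words then produce tableaux that
-- agree except that t is the target (2 at the corner, 2' elsewhere) for b and 1 for ẽ_{1̄} b.
-- The key fact is that inserting letters ≥ 2 never looks at a low prefix of the first row
-- (run-ignores-prefix); an inserted 1 is followed explicitly on both sides.
-- The insertion machine of the definition runs on fuel, so the argument also needs that every
-- insertion of the word completes (a size count against the recording tableau) and that lower
-- rows stay left of the end of the first row (strictness of the shape).

module Submission where

open import Defs
open import Data.Nat
open import Data.Nat.Properties
open import Data.Nat.ListAction using (sum)
open import Data.Bool using (Bool; true; false; if_then_else_)
open import Data.Bool.Properties using (T-≡)
open import Data.Unit using (⊤; tt)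
open import Data.Empty using (⊥; ⊥-elim)
open import Data.Maybe as Maybe using (just; nothing; fromMaybe)
open import Data.Maybe.Properties using (just-injective)
open import Data.List using (List; []; _∷_; _++_; length)
open import Data.List.Properties using (++-assoc; ++-identityʳ; length-++)
open import Data.List.Relation.Unary.All as All using (All; []; _∷_)
open import Data.List.Relation.Unary.All.Properties using (++⁺)
open import Data.List.Relation.Unary.Linked using (Linked; []; [-]; _∷_)
open import Data.Product using (∃; _×_; _,_; proj₁; proj₂)
open import Data.Sum using (_⊎_; inj₁; inj₂)
open import Function using (_∘_; _∘′_; const)
open import Function.Bundles using (Equivalence)
open import Relation.Binary using (tri<; tri≈; tri>)
open import Relation.Binary.PropositionalEquality
open import Relation.Nullary using (¬_; yes; no)

<ᵇ-sound : ∀ {m n} → (m <ᵇ n) ≡ true → m < n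
<ᵇ-sound {m} {n} eq = <ᵇ⇒< m n (Equivalence.from T-≡ eq)

≤ᵇ-sound : ∀ {m n} → (m ≤ᵇ n) ≡ true → m ≤ n
≤ᵇ-sound {m} {n} eq = ≤ᵇ⇒≤ m n (Equivalence.from T-≡ eq)

<ᵇ-true : ∀ {m n} → m < n → (m <ᵇ n) ≡ true
<ᵇ-true = Equivalence.to T-≡ ∘ <⇒<ᵇ

<ᵇ-false : ∀ {m n} → n ≤ m → (m <ᵇ n) ≡ false
<ᵇ-false {m} {n} n≤m with m <ᵇ n in eq
... | false = refl
... | true  = ⊥-elim (<⇒≱ (<ᵇ-sound eq) n≤m)

≤ᵇ-true : ∀ {m n} → m ≤ n → (m ≤ᵇ n) ≡ true
≤ᵇ-true = Equivalence.to T-≡ ∘ ≤⇒≤ᵇ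

≤ᵇ-false : ∀ {m n} → n < m → (m ≤ᵇ n) ≡ false
≤ᵇ-false {m} {n} n<m with m ≤ᵇ n in eq
... | false = refl
... | true  = ⊥-elim (<⇒≱ n<m (≤ᵇ-sound eq))

rowOf : {A : Set} → List (List A) → ℕ → List A
rowOf X r = fromMaybe [] (lookupL X r)

lookup-++ˡ : ∀ {A : Set} (pre rest : List A) c → c < length pre →
             lookupL (pre ++ rest) c ≡ lookupL pre c
lookup-++ˡ (x ∷ pre) rest zero    _         = refl
lookup-++ˡ (x ∷ pre) rest (suc c) (s≤s c<) = lookup-++ˡ pre rest c c<

lookup-++ʳ : ∀ {A : Set} (pre rest : List A) c → length pre ≤ c →
             lookupL (pre ++ rest) c ≡ lookupL rest (c ∸ length pre)
lookup-++ʳ []        rest c       _          = refl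
lookup-++ʳ (x ∷ pre) rest (suc c) (s≤s pre≤) = lookup-++ʳ pre rest c pre≤

lookup-++-offset : ∀ {A : Set} (pre rest : List A) k → lookupL (pre ++ rest) (length pre + k) ≡ lookupL rest k
lookup-++-offset []        rest k = refl
lookup-++-offset (x ∷ pre) rest k = lookup-++-offset pre rest k

updateL-++-offset : ∀ {A : Set} (pre rest : List A) k g →
                    updateL (length pre + k) g (pre ++ rest) ≡ pre ++ updateL k g rest
updateL-++-offset []        rest k g = refl
updateL-++-offset (x ∷ pre) rest k g = cong (x ∷_) (updateL-++-offset pre rest k g)

updateL-++ʳ : ∀ {A : Set} (pre rest : List A) c g → length pre ≤ c →
              updateL c g (pre ++ rest) ≡ pre ++ updateL (c ∸ length pre) g rest
updateL-++ʳ []        rest c       g _          = refl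
updateL-++ʳ (x ∷ pre) rest (suc c) g (s≤s pre≤) = cong (x ∷_) (updateL-++ʳ pre rest c g pre≤)

lookup-defined : ∀ {A : Set} (xs : List A) c → c < length xs → ∃ λ e → lookupL xs c ≡ just e
lookup-defined (x ∷ xs) zero    _        = x , refl
lookup-defined (x ∷ xs) (suc c) (s≤s c<) = lookup-defined xs c c<

lookup-bound : ∀ {A : Set} (xs : List A) c {e} → lookupL xs c ≡ just e → c < length xs
lookup-bound (x ∷ xs) zero    _  = s≤s z≤n
lookup-bound (x ∷ xs) (suc c) eq = s≤s (lookup-bound xs c eq)

lookup-All : ∀ {A : Set} {P : A → Set} {xs : List A} c {e} → All P xs → lookupL xs c ≡ just e → P e
lookup-All zero    (px ∷ _)  refl = px
lookup-All (suc c) (_ ∷ pxs) eq   = lookup-All c pxs eq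

All-updateL : ∀ {A : Set} {P : A → Set} k (g : A → A) → (∀ {a} → P a → P (g a)) →
              {xs : List A} → All P xs → All P (updateL k g xs)
All-updateL k       g Pg []         = []
All-updateL zero    g Pg (px ∷ pxs) = Pg px ∷ pxs
All-updateL (suc k) g Pg (px ∷ pxs) = px ∷ All-updateL k g Pg pxs

All-appendAt : ∀ {A : Set} {P : A → Set} r {x : A} → P x →
               {X : List (List A)} → All (All P) X → All (All P) (appendAt r x X)
All-appendAt zero    px []             = (px ∷ []) ∷ []
All-appendAt zero    px (prow ∷ prows) = ++⁺ prow (px ∷ []) ∷ prows
All-appendAt (suc r) px []             = [] ∷ All-appendAt r px []
All-appendAt (suc r) px (prow ∷ prows) = prow ∷ All-appendAt r px prows

entry-rowOf : ∀ {A : Set} (X : List (List A)) r c → r ≤ c →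
              entry X r c ≡ lookupL (rowOf X r) (c ∸ r)
entry-rowOf X r c r≤c with lookupL X r
... | just row rewrite ≤ᵇ-true r≤c = refl
... | nothing  = refl

run-row-append : ∀ f r x X → firstGreater x (rowOf X r) ≡ nothing →
                 run (suc f) (rowIns r x) X ≡ (appendAt r x X , r)
run-row-append f r x X eq with firstGreater x (rowOf X r)
... | nothing = refl

run-row-bump : ∀ f r x X k y → firstGreater x (rowOf X r) ≡ just k → lookupL (rowOf X r) k ≡ just y →
               run (suc f) (rowIns r x) X ≡ run f (afterBump r (r + k) y) (setEntry X r (r + k) x)
run-row-bump f r x X k y eq ly with firstGreater x (rowOf X r) | eq
... | just _ | refl rewrite ly = refl

run-col-append : ∀ f c x X → colFirst c x 0 X ≡ nothing →
                 run (suc f) (colIns c x) X ≡ (appendAt (colHeight c 0 X) x X , colHeight c 0 X)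
run-col-append f c x X eq with colFirst c x 0 X
... | nothing = refl

run-col-bump : ∀ f c x X r y → colFirst c x 0 X ≡ just r → entry X r c ≡ just y →
               run (suc f) (colIns c x) X ≡ run f (afterBump r c y) (setEntry X r c x)
run-col-bump f c x X r y eq ly with colFirst c x 0 X | eq
... | just _ | refl rewrite ly = refl

firstGreater-hit : ∀ x row k → firstGreater x row ≡ just k →
                   ∃ λ y → lookupL row k ≡ just y × code x < code y
firstGreater-hit x (y ∷ ys) k eq with code x <ᵇ code y in lt
... | true with refl ← eq = y , refl , <ᵇ-sound lt
... | false with firstGreater x ys in eq'
...   | just k' with refl ← eq = firstGreater-hit x ys k' eq'

firstGreater-skip : ∀ x pre rest → All (λ e → code e ≤ code x) pre →
                    firstGreater x (pre ++ rest) ≡ Maybe.map (length pre +_) (firstGreater x rest)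
firstGreater-skip x []        rest []         with firstGreater x rest
... | nothing = refl
... | just k  = refl
firstGreater-skip x (e ∷ pre) rest (e≤x ∷ ps) rewrite <ᵇ-false e≤x | firstGreater-skip x pre rest ps
  with firstGreater x rest
... | nothing = refl
... | just k  = refl

ColumnHit : ℕ → Entry → ℕ → Tableau → ℕ → Set
ColumnHit c z s rs r =
  ∃ λ r₀ → r ≡ s + r₀ × r ≤ c ×
  ∃ λ e → lookupL (rowOf rs r₀) (c ∸ r) ≡ just e × code z < code e

columnHit-later : ∀ c z s row rs r → ColumnHit c z (suc s) rs r → ColumnHit c z s (row ∷ rs) r
columnHit-later c z s row rs r (r₀ , refl , r≤c , hit) = suc r₀ , sym (+-suc s r₀) , r≤c , hit

colFirst-hit : ∀ c z s rs r → colFirst c z s rs ≡ just r → ColumnHit c z s rs r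
colFirst-hit c z s (row ∷ rs) r eq with lookupL row (c ∸ s) in ly | s ≤ᵇ c in le
... | just y | true with code z <ᵇ code y in lt
...   | true with refl ← eq =
        0 , sym (+-identityʳ s) , ≤ᵇ-sound le , y , ly , <ᵇ-sound lt
...   | false = columnHit-later c z s row rs r (colFirst-hit c z (suc s) rs r eq)
colFirst-hit c z s (row ∷ rs) r eq | just y  | false =
  columnHit-later c z s row rs r (colFirst-hit c z (suc s) rs r eq)
colFirst-hit c z s (row ∷ rs) r eq | nothing | _     =
  columnHit-later c z s row rs r (colFirst-hit c z (suc s) rs r eq)

colFirst-pass-absent : ∀ c z row rows → lookupL row c ≡ nothing →
                       colFirst c z 0 (row ∷ rows) ≡ colFirst c z 1 rows
colFirst-pass-absent c z row rows absent rewrite absent = refl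

colFirst-pass-small : ∀ c z row rows e → lookupL row c ≡ just e → code e ≤ code z →
                      colFirst c z 0 (row ∷ rows) ≡ colFirst c z 1 rows
colFirst-pass-small c z row rows e le e≤z rewrite le | <ᵇ-false e≤z = refl

colFirst-bump0 : ∀ c z row rows y → lookupL row c ≡ just y → code z < code y →
                 colFirst c z 0 (row ∷ rows) ≡ just 0
colFirst-bump0 c z row rows y ly z<y rewrite ly | <ᵇ-true z<y = refl

colHeight-absent : ∀ c row rows → lookupL row c ≡ nothing →
                   colHeight c 0 (row ∷ rows) ≡ colHeight c 1 rows
colHeight-absent c row rows absent rewrite absent = refl

colHeight-present : ∀ c row rows e → lookupL row c ≡ just e →
                    colHeight c 0 (row ∷ rows) ≡ suc (colHeight c 1 rows)
colHeight-present c row rows e le rewrite le = refl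

LeftOf : ℕ → ℕ → Tableau → Set
LeftOf c s rs = ∀ r k → k < length (rowOf rs r) → s + r + k < c

leftOf-tail : ∀ c s row rs → LeftOf c s (row ∷ rs) → LeftOf c (suc s) rs
leftOf-tail c s row rs left r k k< = subst (_< c) (cong (_+ k) (+-suc s r)) (left (suc r) k k<)

leftOf-head : ∀ c s row rs → LeftOf c s (row ∷ rs) → s ≤ c → lookupL row (c ∸ s) ≡ nothing
leftOf-head c s row rs left s≤c with lookupL row (c ∸ s) in ly
... | nothing = refl
... | just _  = ⊥-elim (<-irrefl (trans (cong (_+ (c ∸ s)) (+-identityʳ s)) (m+[n∸m]≡n s≤c))
                                  (left 0 (c ∸ s) (lookup-bound row (c ∸ s) ly)))

colFirst-none : ∀ c z s rs → LeftOf c s rs → colFirst c z s rs ≡ nothing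
colFirst-none c z s []         left = refl
colFirst-none c z s (row ∷ rs) left with s ≤? c
... | yes s≤c rewrite leftOf-head c s row rs left s≤c =
      colFirst-none c z (suc s) rs (leftOf-tail c s row rs left)
... | no  s≰c with lookupL row (c ∸ s)
...   | nothing = colFirst-none c z (suc s) rs (leftOf-tail c s row rs left)
...   | just _ rewrite ≤ᵇ-false (≰⇒> s≰c) = colFirst-none c z (suc s) rs (leftOf-tail c s row rs left)

colHeight-none : ∀ c s rs → LeftOf c s rs → colHeight c s rs ≡ 0
colHeight-none c s []         left = refl
colHeight-none c s (row ∷ rs) left with s ≤? c
... | yes s≤c rewrite leftOf-head c s row rs left s≤c | ≤ᵇ-true s≤c =
      colHeight-none c (suc s) rs (leftOf-tail c s row rs left)
... | no  s≰c rewrite ≤ᵇ-false (≰⇒> s≰c) = colHeight-none c (suc s) rs (leftOf-tail c s row rs left)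

addBox : ℕ → List ℕ → List ℕ
addBox zero    []      = 1 ∷ []
addBox zero    (l ∷ s) = suc l ∷ s
addBox (suc r) []      = 0 ∷ addBox r []
addBox (suc r) (l ∷ s) = l ∷ addBox r s

addBox-changes : ∀ r s → s ≢ addBox r s
addBox-changes zero    (l ∷ s) eq = 1+n≢n (sym (cong (λ { [] → 0 ; (a ∷ _) → a }) eq))
addBox-changes (suc r) (l ∷ s) eq = addBox-changes r s (cong (λ { [] → [] ; (_ ∷ t) → t }) eq)

sum-addBox : ∀ r s → sum (addBox r s) ≡ suc (sum s)
sum-addBox zero    []      = refl
sum-addBox zero    (l ∷ s) = refl
sum-addBox (suc r) []      = sum-addBox r []
sum-addBox (suc r) (l ∷ s) = trans (cong (l +_) (sum-addBox r s)) (+-suc l (sum s))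

shape-appendAt : ∀ {A : Set} r (x : A) X → shape (appendAt r x X) ≡ addBox r (shape X)
shape-appendAt zero    x []        = refl
shape-appendAt zero    x (row ∷ X) = cong (_∷ shape X) (trans (length-++ row) (+-comm (length row) 1))
shape-appendAt (suc r) x []        = cong (0 ∷_) (shape-appendAt r x [])
shape-appendAt (suc r) x (row ∷ X) = cong (length row ∷_) (shape-appendAt r x X)

length-updateL : ∀ {A : Set} k (g : A → A) xs → length (updateL k g xs) ≡ length xs
length-updateL k       g []       = refl
length-updateL zero    g (x ∷ xs) = refl
length-updateL (suc k) g (x ∷ xs) = cong suc (length-updateL k g xs)

shape-updateL : ∀ {A : Set} r (g : List A → List A) → (∀ row → length (g row) ≡ length row) →
                ∀ X → shape (updateL r g X) ≡ shape X
shape-updateL r       g keep []        = refl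
shape-updateL zero    g keep (row ∷ X) = cong (_∷ shape X) (keep row)
shape-updateL (suc r) g keep (row ∷ X) = cong (length row ∷_) (shape-updateL r g keep X)

shape-setEntry : ∀ {A : Set} (X : List (List A)) r c e → shape (setEntry X r c e) ≡ shape X
shape-setEntry X r c e = shape-updateL r _ (length-updateL (c ∸ r) (const e)) X

Completes : ℕ → Job → Tableau → Set
Completes f j X = shape (proj₁ (run f j X)) ≡ addBox (proj₂ (run f j X)) (shape X)

-- each bump keeps the shape, so a run either runs out of fuel (shape unchanged) or completes
run-shape : ∀ f j X → shape (proj₁ (run f j X)) ≡ shape X ⊎ Completes f j X
run-shape zero j X = inj₁ refl
run-shape (suc f) (rowIns r x) X with firstGreater x (rowOf X r)
... | nothing = inj₂ (shape-appendAt r x X)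
... | just k
  with run-shape f (afterBump r (r + k) (fromMaybe x (lookupL (rowOf X r) k))) (setEntry X r (r + k) x)
...   | inj₁ e = inj₁ (trans e (shape-setEntry X r (r + k) x))
...   | inj₂ e = inj₂ (trans e (cong (addBox _) (shape-setEntry X r (r + k) x)))
run-shape (suc f) (colIns c x) X with colFirst c x 0 X
... | nothing = inj₂ (shape-appendAt (colHeight c 0 X) x X)
... | just r with run-shape f (afterBump r c (fromMaybe x (entry X r c))) (setEntry X r c x)
...   | inj₁ e = inj₁ (trans e (shape-setEntry X r c x))
...   | inj₂ e = inj₂ (trans e (cong (addBox _) (shape-setEntry X r c x)))

run-more-fuel : ∀ f j X → Completes f j X → run (suc f) j X ≡ run f j X
run-more-fuel zero j X done = ⊥-elim (addBox-changes 0 (shape X) done)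
run-more-fuel (suc f) (rowIns r x) X done with firstGreater x (rowOf X r)
... | nothing = refl
... | just k = run-more-fuel f _ _ (trans done (cong (addBox _) (sym (shape-setEntry X r (r + k) x))))
run-more-fuel (suc f) (colIns c x) X done with colFirst c x 0 X
... | nothing = refl
... | just r = run-more-fuel f _ _ (trans done (cong (addBox _) (sym (shape-setEntry X r c x))))

-- The prefix lemma.

Above Below : ℕ → Entry → Set
Above m e = m ≤ code e
Below m e = code e ≤ m

jobEntry : Job → Entry
jobEntry (rowIns _ x) = x
jobEntry (colIns _ x) = x

code-prime : ∀ a → code a ∸ 1 ≤ code (prime a)
code-prime (unp k) = ≤-refl
code-prime (pr k)  = m∸n≤m (2 * k ∸ 1) 1

afterBump-above : ∀ m r c a → m < code a → Above m (jobEntry (afterBump r c a))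
afterBump-above m r c a m<a with r ≡ᵇ c
afterBump-above m r c a       m<a | true  = ≤-trans (<⇒≤pred m<a) (code-prime a)
afterBump-above m r c (unp k) m<a | false = <⇒≤ m<a
afterBump-above m r c (pr k)  m<a | false = <⇒≤ m<a

LowPrefix : ℕ → ℕ → List Entry → Set
LowPrefix m L pre = length pre ≡ L × All (Below m) pre

below⇒≤ : ∀ {m x pre} → Above m x → All (Below m) pre → All (λ e → code e ≤ code x) pre
below⇒≤ m≤x = All.map (λ e≤m → ≤-trans e≤m m≤x)

record RunIgnores (m f : ℕ) (j : Job) (L : ℕ) (rest : List Entry) (rows : Tableau) : Set where
  constructor ignoring
  field
    rest'       : List Entry
    rows'       : Tableau
    newRow      : ℕ
    rest'-above : All (Above m) rest'
    rows'-above : All (All (Above m)) rows'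
    result      : ∀ pre → LowPrefix m L pre →
                  run f j ((pre ++ rest) ∷ rows) ≡ ((pre ++ rest') ∷ rows' , newRow)

IgnoresPrefix : ℕ → ℕ → ℕ → Set
IgnoresPrefix m f L = ∀ j rest rows → Above m (jobEntry j) → All (Above m) rest → All (All (Above m)) rows →
                      RunIgnores m f j L rest rows

ignores-step : ∀ {m f j j' L rest rows rest₁ rows₁} →
  (∀ pre → LowPrefix m L pre →
           run (suc f) j ((pre ++ rest) ∷ rows) ≡ run f j' ((pre ++ rest₁) ∷ rows₁)) →
  RunIgnores m f j' L rest₁ rows₁ → RunIgnores m (suc f) j L rest rows
ignores-step reduce (ignoring rest' rows' r' hr hrows done) =
  ignoring rest' rows' r' hr hrows λ pre low → trans (reduce pre low) (done pre low)

ignores-append : ∀ {m f j L rest rows} h z → Above m z → All (Above m) rest → All (All (Above m)) rows →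
  (∀ pre → LowPrefix m L pre →
           run (suc f) j ((pre ++ rest) ∷ rows) ≡ (appendAt h z ((pre ++ rest) ∷ rows) , h)) →
  RunIgnores m (suc f) j L rest rows
ignores-append {rest = rest} zero z hz hr hrows stop =
  ignoring (rest ++ z ∷ []) _ 0 (++⁺ hr (hz ∷ [])) hrows
           λ pre low → trans (stop pre low) (cong (λ row → row ∷ _ , 0) (++-assoc pre rest (z ∷ [])))
ignores-append (suc h) z hz hr hrows stop =
  ignoring _ (appendAt h z _) (suc h) hr (All-appendAt h hz hrows) stop

firstRow-bump : ∀ f x pre rest rows k y {L} → length pre ≡ L → All (λ e → code e ≤ code x) pre →
  firstGreater x rest ≡ just k → lookupL rest k ≡ just y →
  run (suc f) (rowIns 0 x) ((pre ++ rest) ∷ rows) ≡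
  run f (afterBump 0 (L + k) y) ((pre ++ updateL k (const x) rest) ∷ rows)
firstRow-bump f x pre rest rows k y refl small fx ly = begin
    run (suc f) (rowIns 0 x) ((pre ++ rest) ∷ rows)
  ≡⟨ run-row-bump f 0 x ((pre ++ rest) ∷ rows) (length pre + k) y
                  (trans (firstGreater-skip x pre rest small) (cong (Maybe.map _) fx))
                  (trans (lookup-++-offset pre rest k) ly) ⟩
    run f (afterBump 0 (length pre + k) y) (updateL (length pre + k) (const x) (pre ++ rest) ∷ rows)
  ≡⟨ cong (λ row → run f _ (row ∷ rows)) (updateL-++-offset pre rest k _) ⟩
    run f (afterBump 0 (length pre + k) y) ((pre ++ updateL k (const x) rest) ∷ rows) ∎
  where open ≡-Reasoning

firstRow-step : ∀ {m f L} → IgnoresPrefix m f L → ∀ x rest rows →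
  Above m x → All (Above m) rest → All (All (Above m)) rows → RunIgnores m (suc f) (rowIns 0 x) L rest rows
firstRow-step {m} {f} {L} IH x rest rows hx hr hrows with firstGreater x rest in fx
... | nothing = ignores-append {f = f} {j = rowIns 0 x} 0 x hx hr hrows λ pre (_ , low) →
      run-row-append f 0 x ((pre ++ rest) ∷ rows)
                     (trans (firstGreater-skip x pre rest (below⇒≤ {x = x} hx low)) (cong (Maybe.map _) fx))
... | just k with firstGreater-hit x rest k fx
...   | y , ly , x<y = ignores-step {f = f} {j = rowIns 0 x}
      (λ pre (eL , low) → firstRow-bump f x pre rest rows k y eL (below⇒≤ {x = x} hx low) fx ly)
      (IH (afterBump 0 (L + k) y) (updateL k (const x) rest) rows
          (afterBump-above m 0 (L + k) y (≤-<-trans hx x<y)) (All-updateL k _ (const hx) hr) hrows)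

lowerRow-step : ∀ {m f L} → IgnoresPrefix m f L → ∀ r x rest rows →
  Above m x → All (Above m) rest → All (All (Above m)) rows →
  RunIgnores m (suc f) (rowIns (suc r) x) L rest rows
lowerRow-step {m} {f} IH r x rest rows hx hr hrows with firstGreater x (rowOf rows r) in fx
... | nothing = ignores-append {f = f} {j = rowIns (suc r) x} (suc r) x hx hr hrows
      λ pre _ → run-row-append f (suc r) x ((pre ++ rest) ∷ rows) fx
... | just k with firstGreater-hit x (rowOf rows r) k fx
...   | y , ly , x<y = ignores-step {f = f} {j = rowIns (suc r) x}
      (λ pre _ → run-row-bump f (suc r) x ((pre ++ rest) ∷ rows) k y fx ly)
      (IH (afterBump (suc r) (suc r + k) y) rest (updateL r (updateL (suc r + k ∸ suc r) (const x)) rows)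
          (afterBump-above m (suc r) (suc r + k) y (≤-<-trans hx x<y)) hr
          (All-updateL r _ (All-updateL (suc r + k ∸ suc r) _ (const hx)) hrows))

Passes : Bool → ℕ → Entry → List Entry → Set
Passes true  c z row = ∃ λ e → lookupL row c ≡ just e × code e ≤ code z
Passes false c z row = lookupL row c ≡ nothing

data FirstRowCell (m c L : ℕ) (z : Entry) (rest : List Entry) : Set where
  bumps  : ∀ y → L ≤ c → lookupL rest (c ∸ L) ≡ just y → code z < code y → FirstRowCell m c L z rest
  passes : ∀ present → (∀ pre → LowPrefix m L pre → Passes present c z (pre ++ rest)) →
           FirstRowCell m c L z rest

lookup-past : ∀ {A : Set} (pre rest : List A) {c L v} → length pre ≡ L → L ≤ c →
              lookupL rest (c ∸ L) ≡ v → lookupL (pre ++ rest) c ≡ v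
lookup-past pre rest {c} refl L≤c eq = trans (lookup-++ʳ pre rest c L≤c) eq

firstRowCell : ∀ m c L z rest → Above m z → FirstRowCell m c L z rest
firstRowCell m c L z rest hz with L ≤? c
... | no L≰c = passes true λ pre (eL , low) →
      let c<pre = subst (c <_) (sym eL) (≰⇒> L≰c)
          (e , le) = lookup-defined pre c c<pre
      in e , trans (lookup-++ˡ pre rest c c<pre) le , ≤-trans (lookup-All c low le) hz
... | yes L≤c with lookupL rest (c ∸ L) in ly
...   | nothing = passes false λ pre (eL , _) → lookup-past pre rest eL L≤c ly
...   | just y with code z <? code y
...     | yes z<y = bumps y L≤c ly z<y
...     | no  z≮y = passes true λ pre (eL , _) → y , lookup-past pre rest eL L≤c ly , ≮⇒≥ z≮y

passes-colFirst : ∀ b c z row rows → Passes b c z row → colFirst c z 0 (row ∷ rows) ≡ colFirst c z 1 rows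
passes-colFirst true  c z row rows (e , le , e≤z) = colFirst-pass-small c z row rows e le e≤z
passes-colFirst false c z row rows absent        = colFirst-pass-absent c z row rows absent

passes-colHeight : ∀ b c z row rows → Passes b c z row →
                   colHeight c 0 (row ∷ rows) ≡ (if b then suc (colHeight c 1 rows) else colHeight c 1 rows)
passes-colHeight true  c z row rows (e , le , _) = colHeight-present c row rows e le
passes-colHeight false c z row rows absent       = colHeight-absent c row rows absent

column-firstRow-bump : ∀ f c z pre rest rows y {L} → length pre ≡ L → L ≤ c →
  lookupL rest (c ∸ L) ≡ just y → code z < code y →
  run (suc f) (colIns c z) ((pre ++ rest) ∷ rows) ≡
  run f (afterBump 0 c y) ((pre ++ updateL (c ∸ L) (const z) rest) ∷ rows)
column-firstRow-bump f c z pre rest rows y refl pre≤c ly z<y = begin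
    run (suc f) (colIns c z) ((pre ++ rest) ∷ rows)
  ≡⟨ run-col-bump f c z ((pre ++ rest) ∷ rows) 0 y (colFirst-bump0 c z (pre ++ rest) rows y ly' z<y) ly' ⟩
    run f (afterBump 0 c y) (updateL c (const z) (pre ++ rest) ∷ rows)
  ≡⟨ cong (λ row → run f _ (row ∷ rows)) (updateL-++ʳ pre rest c _ pre≤c) ⟩
    run f (afterBump 0 c y) ((pre ++ updateL (c ∸ length pre) (const z) rest) ∷ rows) ∎
  where open ≡-Reasoning
        ly' = trans (lookup-++ʳ pre rest c pre≤c) ly

column-step : ∀ {m f L} → IgnoresPrefix m f L → ∀ c z rest rows →
  Above m z → All (Above m) rest → All (All (Above m)) rows → RunIgnores m (suc f) (colIns c z) L rest rows
column-step {m} {f} {L} IH c z rest rows hz hr hrows with firstRowCell m c L z rest hz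
... | bumps y L≤c ly z<y = ignores-step {f = f} {j = colIns c z}
      (λ pre (eL , _) → column-firstRow-bump f c z pre rest rows y eL L≤c ly z<y)
      (IH (afterBump 0 c y) (updateL (c ∸ L) (const z) rest) rows
          (afterBump-above m 0 c y (≤-<-trans hz z<y)) (All-updateL (c ∸ L) _ (const hz) hr) hrows)
... | passes b cell with colFirst c z 1 rows in fz
...   | nothing = ignores-append {f = f} {j = colIns c z} height z hz hr hrows λ pre low →
        let X = (pre ++ rest) ∷ rows in
        trans (run-col-append f c z X (trans (passes-colFirst b c z _ rows (cell pre low)) fz))
              (cong (λ h → appendAt h z X , h) (passes-colHeight b c z _ rows (cell pre low)))
  where height = if b then suc (colHeight c 1 rows) else colHeight c 1 rows
...   | just r with colFirst-hit c z 1 rows r fz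
...     | r₀ , refl , r≤c , e , le , z<e = ignores-step {f = f} {j = colIns c z}
          (λ pre low → let X = (pre ++ rest) ∷ rows in
             run-col-bump f c z X (suc r₀) e (trans (passes-colFirst b c z _ rows (cell pre low)) fz)
                          (trans (entry-rowOf X (suc r₀) c r≤c) le))
          (IH (afterBump (suc r₀) c e) rest (updateL r₀ (updateL (c ∸ suc r₀) (const z)) rows)
              (afterBump-above m (suc r₀) c e (≤-<-trans hz z<e)) hr
              (All-updateL r₀ _ (All-updateL (c ∸ suc r₀) _ (const hz)) hrows))

run-ignores-prefix : ∀ m f L → IgnoresPrefix m f L
run-ignores-prefix m zero    L j rest rows _ hr hrows = ignoring rest rows 0 hr hrows λ _ _ → refl
run-ignores-prefix m (suc f) L (rowIns zero x)    = firstRow-step (run-ignores-prefix m f L) x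
run-ignores-prefix m (suc f) L (rowIns (suc r) x) = lowerRow-step (run-ignores-prefix m f L) r x
run-ignores-prefix m (suc f) L (colIns c z)       = column-step (run-ignores-prefix m f L) c z

-- First rows of the form 1 … 1 t rest.  The evolution after the first 1 or 2 is described by two
-- tableaux with equal remainder (rest, rows) of letters ≥ 2: Marked, whose t is the target of
-- ẽ_{1̄}, and Cleared, whose t is 1.

onesThen : ℕ → Entry → List Entry
onesThen zero    t = t ∷ []
onesThen (suc p) t = unp 1 ∷ onesThen p t

Headed : ℕ → Entry → List Entry → Tableau → Tableau
Headed p t rest rows = (onesThen p t ++ rest) ∷ rows

target : ℕ → Entry
target zero    = unp 2
target (suc _) = pr 2

Marked Cleared : ℕ → List Entry → Tableau → Tableau
Marked  p = Headed p (target p)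
Cleared p = Headed p (unp 1)

length-onesThen : ∀ p t → length (onesThen p t) ≡ suc p
length-onesThen zero    t = refl
length-onesThen (suc p) t = cong suc (length-onesThen p t)

length-onesThen++ : ∀ p t (rest : List Entry) → length (onesThen p t ++ rest) ≡ suc p + length rest
length-onesThen++ zero    t rest = refl
length-onesThen++ (suc p) t rest = cong suc (length-onesThen++ p t rest)

lowPrefix-onesThen : ∀ p t → code t ≤ 4 → LowPrefix 4 (suc p) (onesThen p t)
lowPrefix-onesThen p t t≤4 = length-onesThen p t , low p
  where low : ∀ p → All (Below 4) (onesThen p t)
        low zero    = t≤4 ∷ []
        low (suc p) = s≤s (s≤s z≤n) ∷ low p

code-target≤4 : ∀ p → code (target p) ≤ 4
code-target≤4 zero    = ≤-refl
code-target≤4 (suc p) = s≤s (s≤s (s≤s z≤n))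

shape-Headed : ∀ p t t' rest rows → shape (Headed p t rest rows) ≡ shape (Headed p t' rest rows)
shape-Headed p t t' rest rows =
  cong (_∷ shape rows) (trans (length-onesThen++ p t rest) (sym (length-onesThen++ p t' rest)))

onesThen-shift : ∀ p y (rest : List Entry) → onesThen p (unp 1) ++ y ∷ rest ≡ onesThen (suc p) y ++ rest
onesThen-shift zero    y rest = refl
onesThen-shift (suc p) y rest = cong (unp 1 ∷_) (onesThen-shift p y rest)

onesThen-set : ∀ p t e (rest : List Entry) → updateL p (const e) (onesThen p t ++ rest) ≡ onesThen p e ++ rest
onesThen-set zero    t e rest = refl
onesThen-set (suc p) t e rest = cong (unp 1 ∷_) (onesThen-set p t e rest)

lookup-onesThen-before : ∀ p t (rest : List Entry) i → i < p → lookupL (onesThen p t ++ rest) i ≡ just (unp 1)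
lookup-onesThen-before (suc p) t rest zero    _        = refl
lookup-onesThen-before (suc p) t rest (suc i) (s≤s i<p) = lookup-onesThen-before p t rest i i<p

lookup-onesThen-at : ∀ p t (rest : List Entry) → lookupL (onesThen p t ++ rest) p ≡ just t
lookup-onesThen-at zero    t rest = refl
lookup-onesThen-at (suc p) t rest = lookup-onesThen-at p t rest

lookup-onesThen-after : ∀ p t (rest : List Entry) i → p < i →
                        lookupL (onesThen p t ++ rest) i ≡ lookupL rest (i ∸ suc p)
lookup-onesThen-after zero    t rest (suc i) _         = refl
lookup-onesThen-after (suc p) t rest (suc i) (s≤s p<i) = lookup-onesThen-after p t rest i p<i

firstGreater-onesThen : ∀ p t (rest : List Entry) → 2 < code t →
                        firstGreater (unp 1) (onesThen p t ++ rest) ≡ just p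
firstGreater-onesThen zero    t rest 2<t rewrite <ᵇ-true 2<t = refl
firstGreater-onesThen (suc p) t rest 2<t rewrite firstGreater-onesThen p t rest 2<t = refl

ones-append : ∀ p e → (onesThen p (unp 1) ++ []) ++ e ∷ [] ≡ onesThen (suc p) e ++ []
ones-append p e = trans (cong (_++ e ∷ []) (++-identityʳ (onesThen p (unp 1)))) (onesThen-shift p e [])

firstGreater-ones : ∀ p → firstGreater (unp 1) (onesThen p (unp 1) ++ []) ≡ nothing
firstGreater-ones zero = refl
firstGreater-ones (suc p) rewrite firstGreater-ones p = refl

one-bumps : ∀ f p t rest rows → 2 < code t →
  run (suc f) (rowIns 0 (unp 1)) (Headed p t rest rows) ≡ run f (afterBump 0 p t) (Cleared p rest rows)
one-bumps f p t rest rows 2<t = begin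
    run (suc f) (rowIns 0 (unp 1)) (Headed p t rest rows)
  ≡⟨ run-row-bump f 0 (unp 1) (Headed p t rest rows) p t (firstGreater-onesThen p t rest 2<t)
                  (lookup-onesThen-at p t rest) ⟩
    run f (afterBump 0 p t) (updateL p (const (unp 1)) (onesThen p t ++ rest) ∷ rows)
  ≡⟨ cong (λ row → run f (afterBump 0 p t) (row ∷ rows)) (onesThen-set p t (unp 1) rest) ⟩
    run f (afterBump 0 p t) (Cleared p rest rows) ∎
  where open ≡-Reasoning

one-appends : ∀ f p rows →
              run (suc f) (rowIns 0 (unp 1)) (Cleared p [] rows) ≡ (Cleared (suc p) [] rows , 0)
one-appends f p rows =
  trans (run-row-append f 0 (unp 1) (Cleared p [] rows) (firstGreater-ones p))
        (cong (λ row → row ∷ rows , 0) (ones-append p (unp 1)))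

prime2-bumps : ∀ f p t rest rows → 3 < code t →
  run (suc f) (colIns p (pr 2)) (Headed p t rest rows) ≡ run f (afterBump 0 p t) (Headed p (pr 2) rest rows)
prime2-bumps f p t rest rows 3<t = begin
    run (suc f) (colIns p (pr 2)) (Headed p t rest rows)
  ≡⟨ run-col-bump f p (pr 2) (Headed p t rest rows) 0 t
                  (colFirst-bump0 p (pr 2) (onesThen p t ++ rest) rows t (lookup-onesThen-at p t rest) 3<t)
                  (lookup-onesThen-at p t rest) ⟩
    run f (afterBump 0 p t) (updateL p (const (pr 2)) (onesThen p t ++ rest) ∷ rows)
  ≡⟨ cong (λ row → run f (afterBump 0 p t) (row ∷ rows)) (onesThen-set p t (pr 2) rest) ⟩
    run f (afterBump 0 p t) (Headed p (pr 2) rest rows) ∎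
  where open ≡-Reasoning

prime2-appends : ∀ f p rows → LeftOf (suc p) 1 rows →
  run (suc f) (colIns (suc p) (pr 2)) (Cleared p [] rows) ≡ (Marked (suc p) [] rows , 0)
prime2-appends f p rows left = begin
    run (suc f) (colIns (suc p) (pr 2)) X
  ≡⟨ run-col-append f (suc p) (pr 2) X (trans (colFirst-pass-absent (suc p) (pr 2) row rows absent)
                                              (colFirst-none (suc p) (pr 2) 1 rows left)) ⟩
    (appendAt (colHeight (suc p) 0 X) (pr 2) X , colHeight (suc p) 0 X)
  ≡⟨ cong (λ h → appendAt h (pr 2) X , h) (trans (colHeight-absent (suc p) row rows absent)
                                                 (colHeight-none (suc p) 1 rows left)) ⟩
    (((onesThen p (unp 1) ++ []) ++ pr 2 ∷ []) ∷ rows , 0)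
  ≡⟨ cong (λ row → row ∷ rows , 0) (ones-append p (pr 2)) ⟩
    (Marked (suc p) [] rows , 0) ∎
  where open ≡-Reasoning
        row = onesThen p (unp 1) ++ []
        X = row ∷ rows
        absent = lookup-onesThen-after p (unp 1) [] (suc p) ≤-refl

afterBump-target : ∀ p → afterBump 0 p (target p) ≡ colIns (suc p) (pr 2)
afterBump-target zero    = refl
afterBump-target (suc p) = refl

afterBump-offDiagonal : ∀ q a → jobEntry (afterBump 0 (suc q) a) ≡ a
afterBump-offDiagonal q (unp k) = refl
afterBump-offDiagonal q (pr k)  = refl

insert : ℕ → Tableau → Tableau × ℕ
insert x X = run (fuel X) (rowIns 0 (unp x)) X

fuel-unfold : ∀ X → fuel X ≡ suc (suc (2 * sum (shape X)))
fuel-unfold X = +-comm (2 * sum (shape X)) 2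

fuel-Cleared : ∀ p rest rows → fuel (Cleared p rest rows) ≡ fuel (Marked p rest rows)
fuel-Cleared p rest rows = cong (λ s → 2 * sum s + 2) (shape-Headed p (unp 1) (target p) rest rows)

rowLength : List ℕ → ℕ → ℕ
rowLength sh r = fromMaybe 0 (lookupL sh r)

rowLength-shape : ∀ {A : Set} (X : List (List A)) r → rowLength (shape X) r ≡ length (rowOf X r)
rowLength-shape []      r       = refl
rowLength-shape (x ∷ X) zero    = refl
rowLength-shape (x ∷ X) (suc r) = rowLength-shape X r

-- every box (r+1 , r+1+k) of a lower row lies left of the end of the first row;
-- shifted diagrams of strict partitions have this property
FirstRowCovers : List ℕ → Set
FirstRowCovers sh = ∀ r k → k < rowLength sh (suc r) → suc r + k < rowLength sh 0

InsertionOK : ℕ → Tableau → Set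
InsertionOK x X = FirstRowCovers (shape X) × Completes (fuel X) (rowIns 0 (unp x)) X

covers⇒leftOf : ∀ p t rows → FirstRowCovers (shape (Headed p t [] rows)) → LeftOf (suc p) 1 rows
covers⇒leftOf p t rows covers r k k< =
  subst (suc r + k <_) (trans (length-onesThen++ p t []) (+-identityʳ (suc p)))
        (covers r k (subst (k <_) (sym (rowLength-shape rows r)) k<))

completes-transfer : ∀ f g j j' X Y → run f j X ≡ run g j' Y → shape X ≡ shape Y →
                     Completes f j X → Completes g j' Y
completes-transfer f g j j' X Y same sh done =
  subst (λ R → shape (proj₁ R) ≡ addBox (proj₂ R) (shape Y)) same
        (subst (λ s → shape (proj₁ (run f j X)) ≡ addBox (proj₂ (run f j X)) s) sh done)

-- the invariant of the part of the tableau right of and below the prefix 1 … 1 t: letters ≥ 2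
Large : List Entry → Tableau → Set
Large rest rows = All (Above 4) rest × All (All (Above 4)) rows

record LetterStep (x p : ℕ) (rest : List Entry) (rows : Tableau) : Set where
  constructor stepsTo
  field
    p'      : ℕ
    rest'   : List Entry
    rows'   : Tableau
    large'  : Large rest' rows'
    cleared : proj₁ (insert x (Cleared p rest rows)) ≡ Cleared p' rest' rows'
    marked  : InsertionOK x (Marked p rest rows) → proj₁ (insert x (Marked p rest rows)) ≡ Marked p' rest' rows'

-- letters ≥ 2 pass over the prefix 1 … 1 t and only act on the remainder
large-letter-step : ∀ x p rest rows → 2 ≤ x → Large rest rows → LetterStep x p rest rows
large-letter-step x p rest rows 2≤x (hr , hrows)
  with run-ignores-prefix 4 (fuel (Marked p rest rows)) (suc p) (rowIns 0 (unp x)) rest rows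
                          (*-monoʳ-≤ 2 2≤x) hr hrows
... | ignoring rest' rows' r' hr' hrows' result =
  stepsTo p rest' rows' (hr' , hrows')
    (cong proj₁ (trans (cong (λ f → run f (rowIns 0 (unp x)) (Cleared p rest rows)) (fuel-Cleared p rest rows))
                       (result (onesThen p (unp 1)) (lowPrefix-onesThen p (unp 1) (s≤s (s≤s z≤n))))))
    (λ _ → cong proj₁ (result (onesThen p (target p)) (lowPrefix-onesThen p (target p) (code-target≤4 p))))

2<target : ∀ p → 2 < code (target p)
2<target zero    = s≤s (s≤s (s≤s z≤n))
2<target (suc p) = s≤s (s≤s (s≤s z≤n))

-- 1 into a first row 1 … 1 t with nothing after t: on the cleared side 1 is appended; on the
-- marked side 1 bumps the target, which moves as 2' to the end of the first row
one-step-end : ∀ p rows → Large [] rows → LetterStep 1 p [] rows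
one-step-end p rows (_ , hrows) = stepsTo (suc p) [] rows ([] , hrows)
  (cong proj₁ (trans (cong (λ f → run f (rowIns 0 (unp 1)) C) (fuel-unfold C)) (one-appends _ p rows)))
  λ (covers , _) → cong proj₁ (begin
      run (fuel M) (rowIns 0 (unp 1)) M
    ≡⟨ cong (λ f → run f (rowIns 0 (unp 1)) M) (fuel-unfold M) ⟩
      run (suc (suc G)) (rowIns 0 (unp 1)) M
    ≡⟨ one-bumps (suc G) p (target p) [] rows (2<target p) ⟩
      run (suc G) (afterBump 0 p (target p)) (Cleared p [] rows)
    ≡⟨ cong (λ j → run (suc G) j (Cleared p [] rows)) (afterBump-target p) ⟩
      run (suc G) (colIns (suc p) (pr 2)) (Cleared p [] rows)
    ≡⟨ prime2-appends G p rows (covers⇒leftOf p (target p) rows covers) ⟩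
      (Marked (suc p) [] rows , 0) ∎)
  where open ≡-Reasoning
        C = Cleared p [] rows
        M = Marked p [] rows
        G = 2 * sum (shape M)

cleared-one-bumps : ∀ f p y rest rows → 2 < code y →
  run (suc f) (rowIns 0 (unp 1)) (Cleared p (y ∷ rest) rows) ≡
  run f (afterBump 0 (suc p) y) (Cleared (suc p) rest rows)
cleared-one-bumps f p y rest rows 2<y =
  trans (cong (λ row → run (suc f) (rowIns 0 (unp 1)) (row ∷ rows)) (onesThen-shift p y rest))
        (one-bumps f (suc p) y rest rows 2<y)

-- on the marked side, 1 bumps the target and the resulting 2' bumps y: two steps of the machine
marked-one-bumps : ∀ f p y rest rows → Above 4 y →
  run (suc (suc f)) (rowIns 0 (unp 1)) (Marked p (y ∷ rest) rows) ≡
  run f (afterBump 0 (suc p) y) (Marked (suc p) rest rows)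
marked-one-bumps f p y rest rows hy = begin
    run (suc (suc f)) (rowIns 0 (unp 1)) (Marked p (y ∷ rest) rows)
  ≡⟨ one-bumps (suc f) p (target p) (y ∷ rest) rows (2<target p) ⟩
    run (suc f) (afterBump 0 p (target p)) (Cleared p (y ∷ rest) rows)
  ≡⟨ cong₂ (λ j row → run (suc f) j (row ∷ rows)) (afterBump-target p) (onesThen-shift p y rest) ⟩
    run (suc f) (colIns (suc p) (pr 2)) (Headed (suc p) y rest rows)
  ≡⟨ prime2-bumps f (suc p) y rest rows hy ⟩
    run f (afterBump 0 (suc p) y) (Marked (suc p) rest rows) ∎
  where open ≡-Reasoning

shape-Marked-shift : ∀ p y rest rows → shape (Marked p (y ∷ rest) rows) ≡ shape (Marked (suc p) rest rows)
shape-Marked-shift p y rest rows =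
  trans (shape-Headed p (target p) (unp 1) (y ∷ rest) rows)
        (trans (cong (λ row → length row ∷ shape rows) (onesThen-shift p y rest))
               (shape-Headed (suc p) y (pr 2) rest rows))

-- 1 into a first row 1 … 1 t y rest: y is bumped on both sides and then travels on in the same
-- way; the marked side takes one more step, harmless since its insertion completes
one-step-bump : ∀ p y rest rows → Large (y ∷ rest) rows → LetterStep 1 p (y ∷ rest) rows
one-step-bump p y rest rows (hy ∷ hr , hrows) =
  finish (run-ignores-prefix 4 (suc G) (suc (suc p)) yJob rest rows yJob-large hr hrows)
  where
    M  = Marked p (y ∷ rest) rows
    M' = Marked (suc p) rest rows
    C  = Cleared p (y ∷ rest) rows
    G  = 2 * sum (shape M)
    yJob = afterBump 0 (suc p) y
    yJob-large : Above 4 (jobEntry yJob)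
    yJob-large = subst (Above 4) (sym (afterBump-offDiagonal p y)) hy
    markedRun : insert 1 M ≡ run G yJob M'
    markedRun = trans (cong (λ f → run f (rowIns 0 (unp 1)) M) (fuel-unfold M))
                      (marked-one-bumps G p y rest rows hy)
    markedCompletes : Completes (fuel M) (rowIns 0 (unp 1)) M → Completes G yJob M'
    markedCompletes = completes-transfer (fuel M) G (rowIns 0 (unp 1)) yJob M M' markedRun
                                         (shape-Marked-shift p y rest rows)
    clearedRun : insert 1 C ≡ run (suc G) yJob (Cleared (suc p) rest rows)
    clearedRun = trans (cong (λ f → run f (rowIns 0 (unp 1)) C)
                             (trans (fuel-Cleared p (y ∷ rest) rows) (fuel-unfold M)))
                       (cleared-one-bumps (suc G) p y rest rows (≤-trans (s≤s (s≤s (s≤s z≤n))) hy))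
    finish : RunIgnores 4 (suc G) yJob (suc (suc p)) rest rows → LetterStep 1 p (y ∷ rest) rows
    finish (ignoring rest' rows' r' hr' hrows' result) = stepsTo (suc p) rest' rows' (hr' , hrows')
      (cong proj₁ (trans clearedRun (result (onesThen (suc p) (unp 1)) (lowPrefix-onesThen (suc p) (unp 1) 1≤2))))
      λ (_ , done) → cong proj₁ (begin
          insert 1 M
        ≡⟨ markedRun ⟩
          run G yJob M'
        ≡⟨ sym (run-more-fuel G yJob M' (markedCompletes done)) ⟩
          run (suc G) yJob M'
        ≡⟨ result (onesThen (suc p) (pr 2)) (lowPrefix-onesThen (suc p) (pr 2) (code-target≤4 (suc p))) ⟩
          (Marked (suc p) rest' rows' , r') ∎)
      where open ≡-Reasoning
            1≤2 : code (unp 1) ≤ 4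
            1≤2 = s≤s (s≤s z≤n)

letter-step : ∀ x p rest rows → 1 ≤ x → Large rest rows → LetterStep x p rest rows
letter-step 1             p []         rows _ large = one-step-end p rows large
letter-step 1             p (y ∷ rest) rows _ large = one-step-bump p y rest rows large
letter-step (suc (suc k)) p rest       rows _ large =
  large-letter-step (suc (suc k)) p rest rows (s≤s (s≤s z≤n)) large

insertAll : List ℕ → Tableau → Tableau
insertAll []       X = X
insertAll (x ∷ xs) X = insertAll xs (proj₁ (insert x X))

AllInsertionsOK : List ℕ → Tableau → Set
AllInsertionsOK []       X = ⊤
AllInsertionsOK (x ∷ xs) X = InsertionOK x X × AllInsertionsOK xs (proj₁ (insert x X))

record Evolution (xs : List ℕ) (p : ℕ) (rest : List Entry) (rows : Tableau) : Set where
  constructor evolvesTo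
  field
    p'      : ℕ
    rest'   : List Entry
    rows'   : Tableau
    large'  : Large rest' rows'
    cleared : insertAll xs (Cleared p rest rows) ≡ Cleared p' rest' rows'
    marked  : AllInsertionsOK xs (Marked p rest rows) → insertAll xs (Marked p rest rows) ≡ Marked p' rest' rows'

evolve : ∀ xs p rest rows → All (1 ≤_) xs → Large rest rows → Evolution xs p rest rows
evolve []       p rest rows _           large = evolvesTo p rest rows large refl (const refl)
evolve (x ∷ xs) p rest rows (1≤x ∷ pos) large with letter-step x p rest rows 1≤x large
... | stepsTo p₁ rest₁ rows₁ large₁ cleared₁ marked₁ with evolve xs p₁ rest₁ rows₁ pos large₁
...   | evolvesTo p' rest' rows' large' cleared marked = evolvesTo p' rest' rows' large'
        (trans (cong (insertAll xs) cleared₁) cleared)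
        λ (ok , oks) → trans (cong (insertAll xs) (marked₁ ok))
                             (marked (subst (AllInsertionsOK xs) (marked₁ ok) oks))

-- Before the first 1 or 2: all entries are at least 3'

NoSmallLetters : Tableau → Set
NoSmallLetters = All (All (Above 5))

unp-above5 : ∀ {x} → 3 ≤ x → Above 5 (unp x)
unp-above5 3≤x = ≤-trans (n≤1+n 5) (*-monoʳ-≤ 2 3≤x)

-- inserting a letter ≥ 3 keeps all entries ≥ 3' (the prefix lemma with an empty prefix)
insert-keeps-noSmall : ∀ x X → 3 ≤ x → NoSmallLetters X → NoSmallLetters (proj₁ (insert x X))
insert-keeps-noSmall x []           3≤x []             = (unp-above5 3≤x ∷ []) ∷ []
insert-keeps-noSmall x (row ∷ rows) 3≤x (hrow ∷ hrows)
  with run-ignores-prefix 5 (fuel (row ∷ rows)) 0 (rowIns 0 (unp x)) row rows (unp-above5 3≤x) hrow hrows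
... | ignoring rest' rows' _ hr' hrows' result rewrite result [] (refl , []) = hr' ∷ hrows'

-- the first 1 or 2 (letter a) enters at the corner, bumping its entry (primed, into column 1);
-- what is left right of and below the corner does not depend on a
record Entering (X : Tableau) : Set where
  constructor enters
  field
    rest  : List Entry
    rows  : Tableau
    large : Large rest rows
    first : ∀ a → code (unp a) ≤ 4 → proj₁ (insert a X) ≡ Headed 0 (unp a) rest rows

weaken : ∀ {row} → All (Above 5) row → All (Above 4) row
weaken = All.map λ {e} → ≤-trans (n≤1+n 4)

enter : ∀ X → NoSmallLetters X → Entering X
enter []                  []                  = enters [] [] ([] , []) λ _ _ → refl
enter ([] ∷ rows)         ([] ∷ hrows)        = enters [] rows ([] , All.map weaken hrows) λ a _ →
  cong proj₁ (trans (cong (λ f → run f (rowIns 0 (unp a)) X) (fuel-unfold X))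
                    (run-row-append (suc (2 * sum (shape X))) 0 (unp a) X refl))
  where X = [] ∷ rows
enter ((y ∷ rest) ∷ rows) ((hy ∷ hr) ∷ hrows) = finish
  (run-ignores-prefix 4 (suc G) 1 (colIns 1 (prime y)) rest rows
                      (≤-trans (∸-monoˡ-≤ 1 hy) (code-prime y)) (weaken hr) (All.map weaken hrows))
  where
    X = (y ∷ rest) ∷ rows
    G = 2 * sum (shape X)
    bumpsCorner : ∀ a → code (unp a) ≤ 4 → firstGreater (unp a) (y ∷ rest) ≡ just 0
    bumpsCorner a a≤4 rewrite <ᵇ-true (≤-<-trans a≤4 hy) = refl
    finish : RunIgnores 4 (suc G) (colIns 1 (prime y)) 1 rest rows → Entering X
    finish (ignoring rest' rows' _ hr' hrows' result) = enters rest' rows' (hr' , hrows') λ a a≤4 →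
      cong proj₁ (trans (cong (λ f → run f (rowIns 0 (unp a)) X) (fuel-unfold X))
                 (trans (run-row-bump (suc G) 0 (unp a) X 0 y (bumpsCorner a a≤4) refl)
                        (result (unp a ∷ []) (refl , a≤4 ∷ []))))

HasTargetAt : Tableau → ℕ → Set
HasTargetAt X i = entry X 0 i ≡ just (target i)

NoTarget : Tableau → Set
NoTarget X = ∀ i → ¬ HasTargetAt X i

record UniqueTarget (p : ℕ) (X : Tableau) : Set where
  field
    present : HasTargetAt X p
    unique  : ∀ i → HasTargetAt X i → i ≡ p

no-target-above : ∀ m (row : List Entry) k i → All (Above m) row → code (target i) < m →
                  lookupL row k ≢ just (target i)
no-target-above m row k i above t<m eq = <-irrefl refl (<-≤-trans t<m (lookup-All k above eq))

-- a first-row entry beyond the prefix is large, hence not a target (i > 0 there, so target i = 2')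
rest-not-target : ∀ p t rest i → All (Above 4) rest → p < i →
                  lookupL (onesThen p t ++ rest) i ≢ just (target i)
rest-not-target p t rest (suc i) hr p<i eq = no-target-above 4 rest (suc i ∸ suc p) (suc i) hr ≤-refl
                                               (trans (sym (lookup-onesThen-after p t rest (suc i) p<i)) eq)

one-not-target : ∀ i → just (unp 1) ≢ just (target i)
one-not-target zero    ()
one-not-target (suc i) ()

marked-target : ∀ p rest rows → All (Above 4) rest → UniqueTarget p (Marked p rest rows)
marked-target p rest rows hr = record { present = lookup-onesThen-at p (target p) rest ; unique = unique }
  where
    unique : ∀ i → lookupL (onesThen p (target p) ++ rest) i ≡ just (target i) → i ≡ p
    unique i eq with <-cmp i p
    ... | tri< i<p _ _ =
          ⊥-elim (one-not-target i (trans (sym (lookup-onesThen-before p (target p) rest i i<p)) eq))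
    ... | tri≈ _ i≡p _ = i≡p
    ... | tri> _ _ p<i = ⊥-elim (rest-not-target p (target p) rest i hr p<i eq)

cleared-noTarget : ∀ p rest rows → All (Above 4) rest → NoTarget (Cleared p rest rows)
cleared-noTarget p rest rows hr i eq with <-cmp i p
... | tri< i<p _ _ = one-not-target i (trans (sym (lookup-onesThen-before p (unp 1) rest i i<p)) eq)
... | tri≈ _ refl _ = one-not-target i (trans (sym (lookup-onesThen-at p (unp 1) rest)) eq)
... | tri> _ _ p<i = rest-not-target p (unp 1) rest i hr p<i eq

noSmall-noTarget : ∀ X → NoSmallLetters X → NoTarget X
noSmall-noTarget []            []            i ()
noSmall-noTarget (row ∷ rows)  (hrow ∷ _)    i = no-target-above 5 row i i hrow (s≤s (code-target≤4 i))

data Outcome (b : List ℕ) (X : Tableau) : Set where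
  killed  : e1w b ≡ nothing → NoTarget (insertAll b X) → Outcome b X
  lowered : ∀ {b'} p → e1w b ≡ just b' → insertAll b' X ≡ setEntry (insertAll b X) 0 p (unp 1) →
            UniqueTarget p (insertAll b X) → Outcome b X

setEntry-Marked : ∀ p rest rows → setEntry (Marked p rest rows) 0 p (unp 1) ≡ Cleared p rest rows
setEntry-Marked p rest rows = cong (_∷ rows) (onesThen-set p (target p) (unp 1) rest)

e1w-large : ∀ k xs → e1w (3 + k ∷ xs) ≡ Maybe.map (3 + k ∷_) (e1w xs)
e1w-large k xs with e1w xs
... | nothing = refl
... | just ys = refl

outcome-large : ∀ k xs X → Outcome xs (proj₁ (insert (3 + k) X)) → Outcome (3 + k ∷ xs) X
outcome-large k xs X (killed e nt) = killed (trans (e1w-large k xs) (cong (Maybe.map _) e)) nt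
outcome-large k xs X (lowered p e eq t) = lowered p (trans (e1w-large k xs) (cong (Maybe.map _) e)) eq t

-- the first 1 kills the word: the tableau keeps the form Cleared
outcome-one : ∀ xs X → NoSmallLetters X → All (1 ≤_) xs → Outcome (1 ∷ xs) X
outcome-one xs X small pos with enter X small
... | enters rest rows (hr , hrows) first with evolve xs 0 rest rows pos (hr , hrows)
...   | evolvesTo p' rest' rows' (hr' , _) cleared _ =
  killed refl (subst NoTarget (sym (trans (cong (insertAll xs) (first 1 (s≤s (s≤s z≤n)))) cleared))
                     (cleared-noTarget p' rest' rows' hr'))

-- the first 2 is lowered to 1: the word with 2 gives Marked, the word with 1 gives Cleared
outcome-two : ∀ xs X → NoSmallLetters X → All (1 ≤_) xs → AllInsertionsOK (2 ∷ xs) X →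
              Outcome (2 ∷ xs) X
outcome-two xs X small pos (_ , oks) with enter X small
... | enters rest rows (hr , hrows) first with evolve xs 0 rest rows pos (hr , hrows)
...   | evolvesTo p' rest' rows' (hr' , _) cleared marked =
  lowered p' refl
    (trans (trans (cong (insertAll xs) (first 1 (s≤s (s≤s z≤n)))) cleared)
           (trans (sym (setEntry-Marked p' rest' rows')) (cong (λ Y → setEntry Y 0 p' (unp 1)) (sym markedWord))))
    (subst (UniqueTarget p') (sym markedWord) (marked-target p' rest' rows' hr'))
  where markedWord : insertAll (2 ∷ xs) X ≡ Marked p' rest' rows'
        markedWord = trans (cong (insertAll xs) (first 2 ≤-refl))
                           (marked (subst (AllInsertionsOK xs) (first 2 ≤-refl) oks))

outcome : ∀ xs X → NoSmallLetters X → All (1 ≤_) xs → AllInsertionsOK xs X → Outcome xs X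
outcome []                       X small _         _         = killed refl (noSmall-noTarget X small)
outcome (1 ∷ xs)                 X small (_ ∷ pos) _         = outcome-one xs X small pos
outcome (2 ∷ xs)                 X small (_ ∷ pos) oks       = outcome-two xs X small pos oks
outcome (suc (suc (suc k)) ∷ xs) X small (_ ∷ pos) (_ , oks) =
  outcome-large k xs X (outcome xs _ (insert-keeps-noSmall (3 + k) X (s≤s (s≤s (s≤s z≤n))) small) pos oks)

rowOf-appendAt-same : ∀ {A : Set} r (y : A) X → rowOf (appendAt r y X) r ≡ rowOf X r ++ y ∷ []
rowOf-appendAt-same zero    y []        = refl
rowOf-appendAt-same zero    y (row ∷ X) = refl
rowOf-appendAt-same (suc r) y []        = rowOf-appendAt-same r y []
rowOf-appendAt-same (suc r) y (row ∷ X) = rowOf-appendAt-same r y X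

rowOf-appendAt-other : ∀ {A : Set} r' (y : A) X r → r' ≢ r → rowOf (appendAt r' y X) r ≡ rowOf X r
rowOf-appendAt-other zero     y []        zero    r'≢r = ⊥-elim (r'≢r refl)
rowOf-appendAt-other zero     y []        (suc r) _    = refl
rowOf-appendAt-other zero     y (row ∷ X) zero    r'≢r = ⊥-elim (r'≢r refl)
rowOf-appendAt-other zero     y (row ∷ X) (suc r) _    = refl
rowOf-appendAt-other (suc r') y []        zero    _    = refl
rowOf-appendAt-other (suc r') y []        (suc r) r'≢r = rowOf-appendAt-other r' y [] r (r'≢r ∘′ cong suc)
rowOf-appendAt-other (suc r') y (row ∷ X) zero    _    = refl
rowOf-appendAt-other (suc r') y (row ∷ X) (suc r) r'≢r = rowOf-appendAt-other r' y X r (r'≢r ∘′ cong suc)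

appendAt-keeps : ∀ r' (y : ℕ) Q r k {e} → lookupL (rowOf Q r) k ≡ just e →
                 lookupL (rowOf (appendAt r' y Q) r) k ≡ just e
appendAt-keeps r' y Q r k le with r' ≟ r
... | yes refl rewrite rowOf-appendAt-same r' y Q =
      trans (lookup-++ˡ (rowOf Q r') (y ∷ []) k (lookup-bound (rowOf Q r') k le)) le
... | no r'≢r rewrite rowOf-appendAt-other r' y Q r r'≢r = le

appendAt-new : ∀ r' (y : ℕ) Q r k {e} → length (rowOf Q r) ≤ k →
               lookupL (rowOf (appendAt r' y Q) r) k ≡ just e → e ≡ y
appendAt-new r' y Q r k {e} len≤k le with r' ≟ r
... | yes refl rewrite rowOf-appendAt-same r' y Q = singleton (k ∸ length (rowOf Q r'))
      (trans (sym (lookup-++ʳ (rowOf Q r') (y ∷ []) k len≤k)) le)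
  where singleton : ∀ d → lookupL (y ∷ []) d ≡ just e → e ≡ y
        singleton zero refl = refl
... | no r'≢r rewrite rowOf-appendAt-other r' y Q r r'≢r =
      ⊥-elim (<-irrefl refl (<-≤-trans (lookup-bound (rowOf Q r) k le) len≤k))

Bounded : ℕ → List (List ℕ) → Set
Bounded i Q = ∀ r k {e} → lookupL (rowOf Q r) k ≡ just e → e < i

bounded-appendAt : ∀ i r' Q → Bounded i Q → Bounded (suc i) (appendAt r' i Q)
bounded-appendAt i r' Q bounded r k {e} le with k <? length (rowOf Q r)
... | yes k< = let (e₀ , le₀) = lookup-defined (rowOf Q r) k k<
                   same = just-injective (trans (sym (appendAt-keeps r' i Q r k le₀)) le)
               in subst (_< suc i) same (m<n⇒m<1+n (bounded r k le₀))
... | no  k≮ = subst (_< suc i) (sym (appendAt-new r' i Q r k (≮⇒≥ k≮) le)) ≤-refl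

HM-tableau : ∀ i xs X Q → proj₁ (HM' i xs X Q) ≡ insertAll xs X
HM-tableau i []       X Q = refl
HM-tableau i (x ∷ xs) X Q with run (fuel X) (rowIns 0 (unp x)) X
... | X₁ , r = HM-tableau (suc i) xs X₁ (appendAt r i Q)

HM-keeps : ∀ i xs X Q r k {e} → lookupL (rowOf Q r) k ≡ just e →
           lookupL (rowOf (proj₂ (HM' i xs X Q)) r) k ≡ just e
HM-keeps i []       X Q r k le = le
HM-keeps i (x ∷ xs) X Q r k le with run (fuel X) (rowIns 0 (unp x)) X
... | X₁ , r' = HM-keeps (suc i) xs X₁ (appendAt r' i Q) r k (appendAt-keeps r' i Q r k le)

HM-new : ∀ i xs X Q r k {e} → length (rowOf Q r) ≤ k →
         lookupL (rowOf (proj₂ (HM' i xs X Q)) r) k ≡ just e → i ≤ e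
HM-new i []       X Q r k len≤k le = ⊥-elim (<-irrefl refl (<-≤-trans (lookup-bound (rowOf Q r) k le) len≤k))
HM-new i (x ∷ xs) X Q r k len≤k le with run (fuel X) (rowIns 0 (unp x)) X
... | X₁ , r' with length (rowOf (appendAt r' i Q) r) ≤? k
...   | yes len₁≤k = <⇒≤ (HM-new (suc i) xs X₁ (appendAt r' i Q) r k len₁≤k le)
...   | no  len₁≰k = let (e₀ , le₀) = lookup-defined (rowOf (appendAt r' i Q) r) k (≰⇒> len₁≰k)
                         same = just-injective (trans (sym (HM-keeps (suc i) xs X₁ (appendAt r' i Q) r k le₀)) le)
                     in subst (i ≤_) (trans (sym (appendAt-new r' i Q r k len≤k le₀)) same) ≤-refl

sum-shape-insert : ∀ x X → sum (shape (proj₁ (insert x X))) ≤ suc (sum (shape X))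
sum-shape-insert x X with run-shape (fuel X) (rowIns 0 (unp x)) X
... | inj₁ same = ≤-trans (≤-reflexive (cong sum same)) (n≤1+n _)
... | inj₂ done = ≤-reflexive (trans (cong sum done) (sum-addBox (proj₂ (insert x X)) (shape X)))

sum-shape-insertAll : ∀ xs X → sum (shape (insertAll xs X)) ≤ sum (shape X) + length xs
sum-shape-insertAll []       X = ≤-reflexive (sym (+-identityʳ _))
sum-shape-insertAll (x ∷ xs) X = begin
    sum (shape (insertAll xs (proj₁ (insert x X))))
  ≤⟨ sum-shape-insertAll xs (proj₁ (insert x X)) ⟩
    sum (shape (proj₁ (insert x X))) + length xs
  ≤⟨ +-monoˡ-≤ (length xs) (sum-shape-insert x X) ⟩
    suc (sum (shape X)) + length xs
  ≡⟨ sym (+-suc (sum (shape X)) (length xs)) ⟩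
    sum (shape X) + suc (length xs) ∎
  where open ≤-Reasoning

sum-shape-HM : ∀ i xs X Q → sum (shape (proj₂ (HM' i xs X Q))) ≡ sum (shape Q) + length xs
sum-shape-HM i []       X Q = sym (+-identityʳ _)
sum-shape-HM i (x ∷ xs) X Q with run (fuel X) (rowIns 0 (unp x)) X
... | X₁ , r = trans (sum-shape-HM (suc i) xs X₁ (appendAt r i Q))
                 (trans (cong (_+ length xs) (trans (cong sum (shape-appendAt r i Q)) (sum-addBox r (shape Q))))
                        (sym (+-suc (sum (shape Q)) (length xs))))

ColumnsIncrease : List (List ℕ) → Set
ColumnsIncrease Q = ∀ c r r' e e' → r < r' → entry Q r c ≡ just e → entry Q r' c ≡ just e' → e < e'

-- if the final recording tableau has strictly increasing columns and a covering first row, so has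
-- every intermediate one: a lower box (r+1 , c) beyond the first row would later sit below a
-- first-row box recording a larger number
covers-inherited : ∀ i xs X Q → Bounded i Q → FirstRowCovers (shape (proj₂ (HM' i xs X Q))) →
                   ColumnsIncrease (proj₂ (HM' i xs X Q)) → FirstRowCovers (shape Q)
covers-inherited i xs X Q bounded coversF increasing r k k< with suc r + k <? rowLength (shape Q) 0
... | yes c< = c<
... | no  c≮ = ⊥-elim (<-irrefl refl (<-trans (≤-<-trans i≤e₀ e₀<e) e<i))
  where
    Qf = proj₂ (HM' i xs X Q)
    c = suc r + k
    lower = lookup-defined (rowOf Q (suc r)) k (subst (k <_) (rowLength-shape Q (suc r)) k<)
    e = proj₁ lower
    e<i : e < i
    e<i = bounded (suc r) k (proj₂ lower)
    lowerF = HM-keeps i xs X Q (suc r) k (proj₂ lower)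
    c<F : c < length (rowOf Qf 0)
    c<F = subst (c <_) (rowLength-shape Qf 0) (coversF r k (subst (k <_) (sym (rowLength-shape Qf (suc r)))
                                                                   (lookup-bound (rowOf Qf (suc r)) k lowerF)))
    upperF = lookup-defined (rowOf Qf 0) c c<F
    e₀ = proj₁ upperF
    i≤e₀ : i ≤ e₀
    i≤e₀ = HM-new i xs X Q 0 c (subst (_≤ c) (rowLength-shape Q 0) (≮⇒≥ c≮)) (proj₂ upperF)
    e₀<e : e₀ < e
    e₀<e = increasing c 0 (suc r) e₀ e (s≤s z≤n) (trans (entry-rowOf Qf 0 c z≤n) (proj₂ upperF))
             (trans (entry-rowOf Qf (suc r) c (m≤m+n (suc r) k))
                    (trans (cong (lookupL (rowOf Qf (suc r))) (m+n∸m≡n (suc r) k)) lowerF))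

sizes-differ : ∀ i xs X Q → sum (shape X) < sum (shape Q) →
               shape (proj₁ (HM' i xs X Q)) ≢ shape (proj₂ (HM' i xs X Q))
sizes-differ i xs X Q smaller same = <-irrefl (cong sum same) (begin-strict
    sum (shape (proj₁ (HM' i xs X Q)))
  ≡⟨ cong (sum ∘′ shape) (HM-tableau i xs X Q) ⟩
    sum (shape (insertAll xs X))
  ≤⟨ sum-shape-insertAll xs X ⟩
    sum (shape X) + length xs
  <⟨ +-monoˡ-< (length xs) smaller ⟩
    sum (shape Q) + length xs
  ≡⟨ sym (sum-shape-HM i xs X Q) ⟩
    sum (shape (proj₂ (HM' i xs X Q))) ∎)
  where open ≤-Reasoning

-- by induction along the word: a stalled insertion would make the final shapes differ, and
-- the covering property is inherited from the final recording tableau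
HM-insertionsOK : ∀ i xs X Q → shape X ≡ shape Q → Bounded i Q →
  shape (proj₁ (HM' i xs X Q)) ≡ shape (proj₂ (HM' i xs X Q)) →
  FirstRowCovers (shape (proj₂ (HM' i xs X Q))) → ColumnsIncrease (proj₂ (HM' i xs X Q)) →
  AllInsertionsOK xs X
HM-insertionsOK i []       X Q sameShape bounded sameF coversF increasing = tt
HM-insertionsOK i (x ∷ xs) X Q sameShape bounded sameF coversF increasing
  with covers-inherited i (x ∷ xs) X Q bounded coversF increasing
... | coversQ with run (fuel X) (rowIns 0 (unp x)) X | run-shape (fuel X) (rowIns 0 (unp x)) X
...   | X₁ , r | inj₁ stalled = ⊥-elim (sizes-differ (suc i) xs X₁ (appendAt r i Q) smaller sameF)
  where smaller = subst₂ _<_ (cong sum (sym (trans stalled sameShape)))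
                             (sym (trans (cong sum (shape-appendAt r i Q)) (sum-addBox r (shape Q)))) ≤-refl
...   | X₁ , r | inj₂ done = (subst FirstRowCovers (sym sameShape) coversQ , done) ,
        HM-insertionsOK (suc i) xs X₁ (appendAt r i Q)
                        (trans done (trans (cong (addBox r) sameShape) (sym (shape-appendAt r i Q))))
                        (bounded-appendAt i r Q bounded) sameF coversF increasing

strict⇒covers : ∀ {lam} → Linked Defs._>_ lam → FirstRowCovers lam
strict⇒covers []             r       k ()
strict⇒covers [-]            r       k ()
strict⇒covers (b<a ∷ _)      zero    k k< = ≤-<-trans k< b<a
strict⇒covers (b<a ∷ strict) (suc r) k k< = ≤-<-trans (strict⇒covers strict r k k<) b<a

word-insertionsOK : ∀ b T Q lam → StrictPartition lam → shape T ≡ lam → SYT lam Q → HM b ≡ (T , Q) →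
                    AllInsertionsOK b []
word-insertionsOK b T Q lam (strict , _) shapeT syt hm =
  HM-insertionsOK 1 b [] [] refl (λ _ _ ())
    (atHM (λ R → shape (proj₁ R) ≡ shape (proj₂ R)) (trans shapeT (sym shapeQ)))
    (atHM (FirstRowCovers ∘′ shape ∘′ proj₂) (subst FirstRowCovers (sym shapeQ) (strict⇒covers strict)))
    (atHM (ColumnsIncrease ∘′ proj₂) (SYT.colsInc syt))
  where
    shapeQ = SYT.shapeEq syt
    atHM : (P : Tableau × List (List ℕ) → Set) → P (T , Q) → P (HM' 1 b [] [])
    atHM P = subst P (sym hm)

Conclusion : List ℕ → Tableau → Set
Conclusion b T =
    (entry T 0 0 ≡ just (unp 2) → e1P-word b ≡ just (setEntry T 0 0 (unp 1)))
  × (∀ i → 1 ≤ i → entry T 0 i ≡ just (pr 2) → e1P-word b ≡ just (setEntry T 0 i (unp 1)))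
  × (entry T 0 0 ≢ just (unp 2) → (∀ i → 1 ≤ i → entry T 0 i ≢ just (pr 2)) → e1P-word b ≡ nothing)

e1P-killed : ∀ b → e1w b ≡ nothing → e1P-word b ≡ nothing
e1P-killed b none with e1w b
... | nothing = refl

e1P-lowered : ∀ b {b'} → e1w b ≡ just b' → e1P-word b ≡ just (PHM b')
e1P-lowered b some with e1w b | some
... | just _ | refl = refl

targetSomewhere : ∀ {T} p → HasTargetAt T p →
  entry T 0 0 ≢ just (unp 2) → (∀ i → 1 ≤ i → entry T 0 i ≢ just (pr 2)) → ⊥
targetSomewhere zero    t no2 no2' = no2 t
targetSomewhere (suc q) t no2 no2' = no2' (suc q) (s≤s z≤n) t

outcome⇒conclusion : ∀ b → Outcome b [] → Conclusion b (insertAll b [])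
outcome⇒conclusion b (killed e none) =
  (λ t → ⊥-elim (none 0 t)) , (λ { (suc q) _ t → ⊥-elim (none (suc q) t) }) , λ _ _ → e1P-killed b e
outcome⇒conclusion b (lowered {b'} p e lowers located) =
  (λ t → lowersAt 0 (unique 0 t)) , (λ { (suc q) _ t → lowersAt (suc q) (unique (suc q) t) }) , absent
  where
    open UniqueTarget located
    tab = insertAll b []
    lowersAt : ∀ i → i ≡ p → e1P-word b ≡ just (setEntry tab 0 i (unp 1))
    lowersAt i refl = trans (e1P-lowered b e) (cong just (trans (HM-tableau 1 b' [] []) lowers))
    absent : entry tab 0 0 ≢ just (unp 2) → (∀ i → 1 ≤ i → entry tab 0 i ≢ just (pr 2)) →
             e1P-word b ≡ nothing
    absent no2 no2' = ⊥-elim (targetSomewhere {tab} p present no2 no2')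

lemma3p7 : (n : ℕ) (lam : List ℕ) (T : Tableau) → 2 ≤ n →
           StrictPartition lam → PT n lam T →
           (Q : List (List ℕ)) → SYT lam Q →
           (b : List ℕ) → All (λ x → 1 ≤ x × x ≤ n) b → HM b ≡ (T , Q) →
           ((entry T 0 0 ≡ just (unp 2) →
               e1P-word b ≡ just (setEntry T 0 0 (unp 1)))
           × (∀ i → 1 ≤ i → entry T 0 i ≡ just (pr 2) →
               e1P-word b ≡ just (setEntry T 0 i (unp 1)))
           × (entry T 0 0 ≢ just (unp 2) →
               (∀ i → 1 ≤ i → entry T 0 i ≢ just (pr 2)) →
               e1P-word b ≡ nothing))
lemma3p7 n lam T _ strict pt Q syt b letters hm =
  subst (Conclusion b) (trans (sym (HM-tableau 1 b [] [])) (cong proj₁ hm))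
        (outcome⇒conclusion b (outcome b [] All.[] (All.map proj₁ letters)
                                       (word-insertionsOK b T Q lam strict (PT.shapeEq pt) syt hm)))
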